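{- (Shift removal, negative.) Let $A^-$ be a polarized negative proposition and $P$ an unpolarized proposition with $(A^-)^\bullet = P$. Then there exists a negative proposition $B^-$, not of the form ${\uparrow}{\downarrow}C^-$ for any $C^-$, such that $(B^-)^\bullet = P$ and, for every hypothetical context $\Gamma$ and every stable succedent $U$, if $\Gamma,B^-;\cdot\vdash U$ is derivable then $\Gamma,A^-;\cdot\vdash U$ is derivable.
   Context: Unpolarized propositions: $P ::= p \mid \bot \mid P_1\vee P_2 \mid \top \mid P_1 \wedge P_2 \mid P_1 \supset P_2$. Polarized propositions (each atom has a fixed polarity): $A^+ ::= p^+ \mid {\downarrow}A^- \mid \bot \mid A^+\vee B^+ \mid \top^+ \mid A^+\wedge^+ B^+$; $A^- ::= p^- \mid {\uparrow}A^+ \mid A^+\supset B^- \mid \top^- \mid A^-\wedge^- B^-$. Erasure: $(p^\pm)^\bullet=p$, $({\downarrow}A^-)^\bullet=(A^-)^\bullet$, $({\uparrow}A^+)^\bullet=(A^+)^\bullet$, $\bot^\bullet=\bot$, $(\top^\pm)^\bullet=\top$, $(A\vee B)^\bullet=A^\bullet\vee B^\bullet$, $(A\wedge^\pm B)^\bullet=A^\bullet\wedge B^\bullet$, $(A^+\supset B^-)^\bullet=(A^+)^\bullet\supset(B^-)^\bullet$. Focused calculus: hypothetical contexts (multisets) $\Gamma ::= \cdot \mid \Gamma,A^- \mid \Gamma,\langle A^+\rangle$ ($\langle A^+\rangle$ a suspended positive proposition). Inversion contexts $\Omega$: ordered sequences of positive propositions. Succedents $U ::= [A^+] \mid A^+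 \mid A^- \mid \langle A^-\rangle$; $U$ is stable iff of the form $A^+$ or $\langle A^-\rangle$. Three sequent forms: right focus $\Gamma\vdash[A^+]$; inversion $\Gamma;\Omega\vdash U$ ($U$ not of the form $[A^+]$); left focus $\Gamma;[A^-]\vdash U$ ($U$ stable). Rules. Right focus: $id^+$: $\Gamma,\langle A^+\rangle\vdash[A^+]$; ${\downarrow}_R$: from $\Gamma;\cdot\vdash A^-$ infer $\Gamma\vdash[{\downarrow}A^-]$; $\vee_{R1}$/$\vee_{R2}$: from $\Gamma\vdash[A^+]$ (resp. $[B^+]$) infer $\Gamma\vdash[A^+\vee B^+]$; $\top^+_R$: $\Gamma\vdash[\top^+]$; $\wedge^+_R$: from $\Gamma\vdash[A^+]$, $\Gamma\vdash[B^+]$ infer $\Gamma\vdash[A^+\wedge^+B^+]$. Inversion: $foc_R$: from $\Gamma\vdash[A^+]$ infer $\Gamma;\cdot\vdash A^+$; $foc_L$: from $\Gamma,A^-;[A^-]\vdash U$, $U$ stable, infer $\Gamma,A^-;\cdot\vdash U$; $\eta^+$: from $\Gamma,\langle p^+\rangle;\Omega\vdash U$ infer $\Gamma;p^+,\Omega\vdash U$; ${\downarrow}_L$: from $\Gamma,A^-;\Omega\vdash U$ infer $\Gamma;{\downarrow}A^-,\Omega\vdash U$; $\bot_L$: $\Gamma;\bot,\Omega\vdash U$; $\vee_L$: from $\Gamma;A^+,\Omega\vdash U$ and $\Gamma;B^+,\Omega\vdash U$ infer $\Gamma;A^+\vee B^+,\Omega\vdash U$; $\top^+_L$: from $\Gamma;\Omega\vdash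 U$ infer $\Gamma;\top^+,\Omega\vdash U$; $\wedge^+_L$: from $\Gamma;A^+,B^+,\Omega\vdash U$ infer $\Gamma;A^+\wedge^+B^+,\Omega\vdash U$; $\eta^-$: from $\Gamma;\cdot\vdash\langle p^-\rangle$ infer $\Gamma;\cdot\vdash p^-$; ${\uparrow}_R$: from $\Gamma;\cdot\vdash A^+$ infer $\Gamma;\cdot\vdash{\uparrow}A^+$; $\supset_R$: from $\Gamma;A^+\vdash B^-$ infer $\Gamma;\cdot\vdash A^+\supset B^-$; $\top^-_R$: $\Gamma;\cdot\vdash\top^-$; $\wedge^-_R$: from $\Gamma;\cdot\vdash A^-$ and $\Gamma;\cdot\vdash B^-$ infer $\Gamma;\cdot\vdash A^-\wedge^-B^-$. Left focus: $id^-$: $\Gamma;[A^-]\vdash\langle A^-\rangle$; ${\uparrow}_L$: from $\Gamma;A^+\vdash U$ infer $\Gamma;[{\uparrow}A^+]\vdash U$; $\supset_L$: from $\Gamma\vdash[A^+]$ and $\Gamma;[B^-]\vdash U$ infer $\Gamma;[A^+\supset B^-]\vdash U$; $\wedge^-_{L1}$/$\wedge^-_{L2}$: from $\Gamma;[A^-]\vdash U$ (resp. $[B^-]$) infer $\Gamma;[A^-\wedge^-B^-]\vdash U$. (No $\bot_R$, no $\top^-_L$.) -}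

module Defs where

open import Data.List using (List; []; _∷_)
open import Data.List.Membership.Propositional using (_∈_)
open import Relation.Binary.PropositionalEquality using (_≡_)

data Polarity : Set where
  positive negative : Polarity

module Logic (Atom : Set) (pol : Atom → Polarity) where

  data Prop : Set where
    atom : Atom → Prop
    ⊥ₚ   : Prop
    _∨ₚ_ : Prop → Prop → Prop
    ⊤ₚ   : Prop
    _∧ₚ_ : Prop → Prop → Prop
    _⊃ₚ_ : Prop → Prop → Prop

  data Pos : Set
  data Neg : Set

  data Pos where
    p⁺   : (a : Atom) → pol a ≡ positive → Pos
    ↓    : Neg → Pos
    ⊥⁺   : Pos
    _∨⁺_ : Pos → Pos → Pos
    ⊤⁺   : Pos
    _∧⁺_ : Pos → Pos → Pos

  data Neg where
    p⁻   : (a : Atom) → pol a ≡ negative → Neg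
    ↑    : Pos → Neg
    _⊃_  : Pos → Neg → Neg
    ⊤⁻   : Neg
    _∧⁻_ : Neg → Neg → Neg

  eraseP : Pos → Prop
  eraseN : Neg → Prop
  eraseP (p⁺ a _)  = atom a
  eraseP (↓ A)     = eraseN A
  eraseP ⊥⁺        = ⊥ₚ
  eraseP (A ∨⁺ B)  = eraseP A ∨ₚ eraseP B
  eraseP ⊤⁺        = ⊤ₚ
  eraseP (A ∧⁺ B)  = eraseP A ∧ₚ eraseP B
  eraseN (p⁻ a _)  = atom a
  eraseN (↑ A)     = eraseP A
  eraseN (A ⊃ B)   = eraseP A ⊃ₚ eraseN B
  eraseN ⊤⁻        = ⊤ₚ
  eraseN (A ∧⁻ B)  = eraseN A ∧ₚ eraseN B

  data Hyp : Set where
    hneg  : Neg → Hyp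
    hsusp : Pos → Hyp

  -- Hypothetical contexts (multisets, represented as lists; all rules
  -- access hypotheses via membership, so order is irrelevant).
  Ctx : Set
  Ctx = List Hyp

  InvCtx : Set
  InvCtx = List Pos

  data Stable : Set where
    spos  : Pos → Stable
    ssusp : Neg → Stable

  -- Succedents allowed in inversion sequents (not of the form [A⁺]).
  data ISucc : Set where
    ipos  : Pos → ISucc
    ineg  : Neg → ISucc
    isusp : Neg → ISucc

  stab : Stable → ISucc
  stab (spos A)  = ipos A
  stab (ssusp A) = isusp A

  -- Right focus Γ ⊢ [A⁺]; inversion Γ;Ω ⊢ U; left focus Γ;[A⁻] ⊢ U.
  data RFoc : Ctx → Pos → Set
  data Inv  : Ctx → InvCtx → ISucc → Set
  data LFoc : Ctx → Neg → Stable → Set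

  data RFoc where
    id⁺  : ∀ {Γ A} → hsusp A ∈ Γ → RFoc Γ A
    ↓R   : ∀ {Γ A} → Inv Γ [] (ineg A) → RFoc Γ (↓ A)
    ∨R₁  : ∀ {Γ A B} → RFoc Γ A → RFoc Γ (A ∨⁺ B)
    ∨R₂  : ∀ {Γ A B} → RFoc Γ B → RFoc Γ (A ∨⁺ B)
    ⊤⁺R  : ∀ {Γ} → RFoc Γ ⊤⁺
    ∧⁺R  : ∀ {Γ A B} → RFoc Γ A → RFoc Γ B → RFoc Γ (A ∧⁺ B)

  data Inv where
    focR : ∀ {Γ A} → RFoc Γ A → Inv Γ [] (ipos A)
    focL : ∀ {Γ A U} → hneg A ∈ Γ → LFoc Γ A U → Inv Γ [] (stab U)
    η⁺   : ∀ {Γ Ω U a e} → Inv (hsusp (p⁺ a e) ∷ Γ) Ω U → Inv Γ (p⁺ a e ∷ Ω) U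
    ↓L   : ∀ {Γ Ω U A} → Inv (hneg A ∷ Γ) Ω U → Inv Γ (↓ A ∷ Ω) U
    ⊥L   : ∀ {Γ Ω U} → Inv Γ (⊥⁺ ∷ Ω) U
    ∨L   : ∀ {Γ Ω U A B} → Inv Γ (A ∷ Ω) U → Inv Γ (B ∷ Ω) U → Inv Γ ((A ∨⁺ B) ∷ Ω) U
    ⊤⁺L  : ∀ {Γ Ω U} → Inv Γ Ω U → Inv Γ (⊤⁺ ∷ Ω) U
    ∧⁺L  : ∀ {Γ Ω U A B} → Inv Γ (A ∷ B ∷ Ω) U → Inv Γ ((A ∧⁺ B) ∷ Ω) U
    η⁻   : ∀ {Γ a e} → Inv Γ [] (isusp (p⁻ a e)) → Inv Γ [] (ineg (p⁻ a e))
    ↑R   : ∀ {Γ A} → Inv Γ [] (ipos A) → Inv Γ [] (ineg (↑ A))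
    ⊃R   : ∀ {Γ A B} → Inv Γ (A ∷ []) (ineg B) → Inv Γ [] (ineg (A ⊃ B))
    ⊤⁻R  : ∀ {Γ} → Inv Γ [] (ineg ⊤⁻)
    ∧⁻R  : ∀ {Γ A B} → Inv Γ [] (ineg A) → Inv Γ [] (ineg B) → Inv Γ [] (ineg (A ∧⁻ B))

  data LFoc where
    id⁻  : ∀ {Γ A} → LFoc Γ A (ssusp A)
    ↑L   : ∀ {Γ A U} → Inv Γ (A ∷ []) (stab U) → LFoc Γ (↑ A) U
    ⊃L   : ∀ {Γ A B U} → RFoc Γ A → LFoc Γ B U → LFoc Γ (A ⊃ B) U
    ∧⁻L₁ : ∀ {Γ A B U} → LFoc Γ A U → LFoc Γ (A ∧⁻ B) U
    ∧⁻L₂ : ∀ {Γ A B U} → LFoc Γ B U → LFoc Γ (A ∧⁻ B) U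

-- Every negative proposition A⁻ has the shape ↑↓…↑↓B⁻ where B⁻ is not
-- itself of the form ↑↓C⁻; call B⁻ = strip A⁻.  Shifts are invisible to
-- erasure, so strip A⁻ erases to the same unpolarized proposition as A⁻.
-- The remaining point is that a hypothesis strip A⁻ can be replaced by
-- A⁻ in any stable inversion sequent.  It suffices to treat one layer of
-- shifts: from Γ, C⁻ ; · ⊢ U we obtain Γ, ↑↓C⁻ ; · ⊢ U by focusing on
-- ↑↓C⁻ and inverting (↑L, then ↓L), which leaves Γ, ↑↓C⁻, C⁻ ; · ⊢ U —
-- the original sequent weakened by ↑↓C⁻.

module Submission where

open import Defs
open import Data.List using ([]; _∷_)
open import Data.List.Relation.Binary.Subset.Propositional using (_⊆_)
open import Data.List.Relation.Binary.Subset.Propositional.Properties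
  using (∷⁺ʳ; xs⊆x∷xs)
open import Data.List.Relation.Unary.Any using (here)
open import Data.Product using (Σ; ∃; _×_; _,_)
open import Data.Sum using (_⊎_; inj₁; inj₂)
open import Relation.Nullary using (¬_)
open import Relation.Binary.PropositionalEquality using (_≡_; refl)

module ShiftRemoval (Atom : Set) (pol : Atom → Polarity) where
  open Logic Atom pol

  -- Weakening: every derivation remains valid in a larger context,
  -- since all rules consult Γ only through membership.
  weakenR : ∀ {Γ Δ A} → Γ ⊆ Δ → RFoc Γ A → RFoc Δ A
  weakenI : ∀ {Γ Δ Ω U} → Γ ⊆ Δ → Inv Γ Ω U → Inv Δ Ω U
  weakenL : ∀ {Γ Δ A U} → Γ ⊆ Δ → LFoc Γ A U → LFoc Δ A U

  weakenR Γ⊆Δ (id⁺ x)   = id⁺ (Γ⊆Δ x)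
  weakenR Γ⊆Δ (↓R d)    = ↓R (weakenI Γ⊆Δ d)
  weakenR Γ⊆Δ (∨R₁ d)   = ∨R₁ (weakenR Γ⊆Δ d)
  weakenR Γ⊆Δ (∨R₂ d)   = ∨R₂ (weakenR Γ⊆Δ d)
  weakenR Γ⊆Δ ⊤⁺R       = ⊤⁺R
  weakenR Γ⊆Δ (∧⁺R d e) = ∧⁺R (weakenR Γ⊆Δ d) (weakenR Γ⊆Δ e)

  weakenI Γ⊆Δ (focR d)   = focR (weakenR Γ⊆Δ d)
  weakenI Γ⊆Δ (focL x d) = focL (Γ⊆Δ x) (weakenL Γ⊆Δ d)
  weakenI Γ⊆Δ (η⁺ d)     = η⁺ (weakenI (∷⁺ʳ _ Γ⊆Δ) d)
  weakenI Γ⊆Δ (↓L d)     = ↓L (weakenI (∷⁺ʳ _ Γ⊆Δ) d)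
  weakenI Γ⊆Δ ⊥L         = ⊥L
  weakenI Γ⊆Δ (∨L d e)   = ∨L (weakenI Γ⊆Δ d) (weakenI Γ⊆Δ e)
  weakenI Γ⊆Δ (⊤⁺L d)    = ⊤⁺L (weakenI Γ⊆Δ d)
  weakenI Γ⊆Δ (∧⁺L d)    = ∧⁺L (weakenI Γ⊆Δ d)
  weakenI Γ⊆Δ (η⁻ d)     = η⁻ (weakenI Γ⊆Δ d)
  weakenI Γ⊆Δ (↑R d)     = ↑R (weakenI Γ⊆Δ d)
  weakenI Γ⊆Δ (⊃R d)     = ⊃R (weakenI Γ⊆Δ d)
  weakenI Γ⊆Δ ⊤⁻R        = ⊤⁻R
  weakenI Γ⊆Δ (∧⁻R d e)  = ∧⁻R (weakenI Γ⊆Δ d) (weakenI Γ⊆Δ e)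

  weakenL Γ⊆Δ id⁻        = id⁻
  weakenL Γ⊆Δ (↑L d)     = ↑L (weakenI Γ⊆Δ d)
  weakenL Γ⊆Δ (⊃L d e)   = ⊃L (weakenR Γ⊆Δ d) (weakenL Γ⊆Δ e)
  weakenL Γ⊆Δ (∧⁻L₁ d)   = ∧⁻L₁ (weakenL Γ⊆Δ d)
  weakenL Γ⊆Δ (∧⁻L₂ d)   = ∧⁻L₂ (weakenL Γ⊆Δ d)

  -- One layer of shifts may be added to a hypothesis: focus on ↑↓C,
  -- invert it back to C, and reuse the given derivation by weakening.
  shiftHyp : ∀ C Γ (U : Stable) →
    Inv (hneg C ∷ Γ) [] (stab U) → Inv (hneg (↑ (↓ C)) ∷ Γ) [] (stab U)
  shiftHyp C Γ U d =
    focL (here refl) (↑L (↓L (weakenI (∷⁺ʳ (hneg C) (xs⊆x∷xs Γ _)) d)))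

  DoubleShift : Neg → Set
  DoubleShift A = ∃ λ C → A ≡ ↑ (↓ C)

  doubleShift? : ∀ A → DoubleShift A ⊎ ¬ DoubleShift A
  doubleShift? (↑ (↓ C))    = inj₁ (C , refl)
  doubleShift? (p⁻ a x)     = inj₂ λ { (_ , ()) }
  doubleShift? (↑ (p⁺ a x)) = inj₂ λ { (_ , ()) }
  doubleShift? (↑ ⊥⁺)       = inj₂ λ { (_ , ()) }
  doubleShift? (↑ (A ∨⁺ B)) = inj₂ λ { (_ , ()) }
  doubleShift? (↑ ⊤⁺)       = inj₂ λ { (_ , ()) }
  doubleShift? (↑ (A ∧⁺ B)) = inj₂ λ { (_ , ()) }
  doubleShift? (A ⊃ B)      = inj₂ λ { (_ , ()) }
  doubleShift? ⊤⁻           = inj₂ λ { (_ , ()) }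
  doubleShift? (A ∧⁻ B)     = inj₂ λ { (_ , ()) }

  strip : Neg → Neg
  strip A with doubleShift? A
  ... | inj₁ (C , refl) = strip C
  ... | inj₂ _          = A

  strip-noDoubleShift : ∀ A → ¬ DoubleShift (strip A)
  strip-noDoubleShift A with doubleShift? A
  ... | inj₁ (C , refl) = strip-noDoubleShift C
  ... | inj₂ ¬ds        = ¬ds

  strip-erase : ∀ A → eraseN (strip A) ≡ eraseN A
  strip-erase A with doubleShift? A
  ... | inj₁ (C , refl) = strip-erase C
  ... | inj₂ _          = refl

  strip-hyp : ∀ A Γ (U : Stable) →
    Inv (hneg (strip A) ∷ Γ) [] (stab U) → Inv (hneg A ∷ Γ) [] (stab U)
  strip-hyp A Γ U d with doubleShift? A
  ... | inj₁ (C , refl) = shiftHyp C Γ U (strip-hyp C Γ U d)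
  ... | inj₂ _          = d

lemma2 : (Atom : Set) (pol : Atom → Polarity) →
    let open Logic Atom pol in
    (A : Neg) (P : Prop) → eraseN A ≡ P →
    Σ Neg (λ B →
      (¬ ∃ (λ C → B ≡ ↑ (↓ C))) ×
      (eraseN B ≡ P) ×
      ((Γ : Ctx) (U : Stable) →
        Inv (hneg B ∷ Γ) [] (stab U) → Inv (hneg A ∷ Γ) [] (stab U)))
lemma2 Atom pol A _ refl =
  strip A , strip-noDoubleShift A , strip-erase A , strip-hyp A
  where open ShiftRemoval Atom pol
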